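{- For every integer $m\geq 3$, $\lambda_1^1(P_m \times C_5)=4$.
   Context: For a graph $G$, an $L(1,1)$-labeling with labels in $\{0,1,\dots,p\}$ is a function $l:V(G)\to\{0,1,\dots,p\}$ such that $l(u)\neq l(v)$ whenever the distance $d(u,v)$ is $1$ or $2$. $\lambda_1^1(G)$ denotes the least $p$ for which $G$ admits such a labeling. $P_m$ denotes the path with $m$ vertices and $C_n$ the cycle with $n$ vertices. The direct product $G\times H$ has vertex set $V(G)\times V(H)$, with $(x_1,x_2)$ adjacent to $(y_1,y_2)$ iff $x_1y_1\in E(G)$ and $x_2y_2\in E(H)$. -}

module Defs where

open import Data.Nat using (ℕ; suc; _≤_; _%_; NonZero)
open import Data.Fin using (Fin; toℕ)
open import Data.Product using (_×_; Σ; ∃-syntax; _,_; proj₁; proj₂)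
open import Data.Sum using (_⊎_)
open import Relation.Binary.PropositionalEquality using (_≡_; _≢_)

record Graph : Set₁ where
  field
    V   : Set
    Adj : V → V → Set
open Graph public

Path : ℕ → Graph
Path m = record
  { V = Fin m
  ; Adj = λ i j → (toℕ j ≡ suc (toℕ i)) ⊎ (toℕ i ≡ suc (toℕ j)) }

-- Cycle C_n on vertices 0..n-1 (meant for n ≥ 3):
-- i ~ j iff j ≡ i+1 (mod n) or i ≡ j+1 (mod n).
Cycle : (n : ℕ) → .{{NonZero n}} → Graph
Cycle n = record
  { V = Fin n
  ; Adj = λ i j → (toℕ j ≡ suc (toℕ i) % n) ⊎ (toℕ i ≡ suc (toℕ j) % n) }

_×ᵍ_ : Graph → Graph → Graph
G ×ᵍ H = record
  { V = V G × V H
  ; Adj = λ x y → Adj G (proj₁ x) (proj₁ y) × Adj H (proj₂ x) (proj₂ y) }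

Dist1or2 : (G : Graph) → V G → V G → Set
Dist1or2 G u v = u ≢ v × (Adj G u v ⊎ ∃[ w ] (Adj G u w × Adj G w v))

L11Labeling : Graph → ℕ → Set
L11Labeling G p =
  Σ (V G → ℕ) λ l → (∀ v → l v ≤ p) × (∀ u v → Dist1or2 G u v → l u ≢ l v)

λ₁¹≡ : Graph → ℕ → Set
λ₁¹≡ G p = L11Labeling G p × (∀ q → L11Labeling G q → p ≤ q)

-- Upper bound: i ↦ i mod 5 is a locally injective homomorphism P_m → C_5, so
-- P_m × C_5 maps locally injectively into C_5 × C_5; such maps preserve being at
-- distance 1 or 2, so they pull back the labeling (a , b) ↦ a + 2b mod 5 of C_5 × C_5.
-- Lower bound: for m ≥ 3 the vertex (1 , 0) has four neighbours, and a vertex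
-- together with its neighbours needs pairwise distinct labels.
module Submission where

open import Defs
open import Data.Nat using (ℕ; suc; _+_; _*_; _/_; _%_; _≤_; NonZero; s≤s; z≤n)
open import Data.Nat.Properties using (+-comm; +-assoc; +-cancelˡ-≡; ≤-pred; <⇒≱)
import Data.Nat.Properties as ℕ
open import Data.Nat.DivMod using (_mod_; m%n<n; m≡m%n+[m/n]*n; %-congˡ; %-distribˡ-+; m%n%n≡m%n; m<n⇒m%n≡m)
open import Data.Nat.Divisibility using (_∣_; divides; n∣m*n; ∣m+n∣m⇒∣n; ∣⇒≤)
open import Data.Fin using (Fin; toℕ; fromℕ<) renaming (zero to fz; suc to fs)
open import Data.Fin.Properties using (toℕ-injective; toℕ-fromℕ<; toℕ<n; all?; any?; injective⇒≤)
import Data.Fin.Properties as Fin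
open import Data.Vec.Functional using (_∷_)
open import Data.Product using (_×_; ∃-syntax; _,_; proj₁; proj₂; map)
open import Data.Product.Properties using (≡-dec)
open import Data.Sum using (_⊎_; inj₁; inj₂)
open import Data.Empty using (⊥-elim)
open import Function using (_∘_; id)
open import Function.Definitions using (Injective)
open import Relation.Binary.Definitions using (Irreflexive; Decidable)
open import Relation.Nullary.Decidable using (toWitness; decidable-stable; _⊎-dec_; _×-dec_; _→-dec_; ¬?)
open import Relation.Binary.PropositionalEquality using (_≡_; _≢_; refl; sym; trans; cong; cong₂; module ≡-Reasoning)

Adj² : (G : Graph) → V G → V G → Set
Adj² G u v = ∃[ w ] (Adj G u w × Adj G w v)

IsIrreflexive : Graph → Set
IsIrreflexive G = Irreflexive _≡_ (Adj G)

×ᵍ-irreflexiveʳ : ∀ {G H} → IsIrreflexive H → IsIrreflexive (G ×ᵍ H)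
×ᵍ-irreflexiveʳ irr refl (_ , h) = irr refl h

[k+m]%n≡m%n⇒n∣k : ∀ k m n .{{_ : NonZero n}} → (k + m) % n ≡ m % n → n ∣ k
[k+m]%n≡m%n⇒n∣k k m n eq = ∣m+n∣m⇒∣n (divides ((k + m) / n) (+-cancelˡ-≡ (m % n) _ _ chain)) (n∣m*n (m / n))
  where
  open ≡-Reasoning
  chain : m % n + (m / n * n + k) ≡ m % n + (k + m) / n * n
  chain = begin
    m % n + (m / n * n + k)   ≡⟨ sym (+-assoc (m % n) _ k) ⟩
    m % n + m / n * n + k     ≡⟨ cong (_+ k) (sym (m≡m%n+[m/n]*n m n)) ⟩
    m + k                     ≡⟨ +-comm m k ⟩
    k + m                     ≡⟨ m≡m%n+[m/n]*n (k + m) n ⟩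
    (k + m) % n + (k + m) / n * n
                              ≡⟨ cong (_+ (k + m) / n * n) eq ⟩
    m % n + (k + m) / n * n   ∎

[1+m]%n≡[1+m%n]%n : ∀ x n .{{_ : NonZero n}} → suc x % n ≡ suc (x % n) % n
[1+m]%n≡[1+m%n]%n x n = begin
  (1 + x) % n                 ≡⟨ %-distribˡ-+ 1 x n ⟩
  (1 % n + x % n) % n         ≡⟨ cong (λ y → (1 % n + y) % n) (sym (m%n%n≡m%n x n)) ⟩
  (1 % n + x % n % n) % n     ≡⟨ sym (%-distribˡ-+ 1 (x % n) n) ⟩
  (1 + x % n) % n             ∎
  where open ≡-Reasoning

cycle-adj? : ∀ n .{{_ : NonZero n}} → Decidable (Adj (Cycle n))
cycle-adj? n i j = (toℕ j ℕ.≟ suc (toℕ i) % n) ⊎-dec (toℕ i ℕ.≟ suc (toℕ j) % n)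

cycle-irreflexive : ∀ {n} .{{_ : NonZero n}} → 2 ≤ n → IsIrreflexive (Cycle n)
cycle-irreflexive {n} 2≤n {i} refl loop = <⇒≱ 2≤n (∣⇒≤ (n∣1 loop))
  where
  n∣1 : Adj (Cycle n) i i → n ∣ 1
  n∣1 (inj₁ e) = [k+m]%n≡m%n⇒n∣k 1 (toℕ i) n (trans (sym e) (sym (m<n⇒m%n≡m (toℕ<n i))))
  n∣1 (inj₂ e) = [k+m]%n≡m%n⇒n∣k 1 (toℕ i) n (trans (sym e) (sym (m<n⇒m%n≡m (toℕ<n i))))

record LocallyInjectiveHom (G H : Graph) : Set where
  field
    ⟦_⟧               : V G → V H
    homomorphic       : ∀ {u v} → Adj G u v → Adj H (⟦ u ⟧) (⟦ v ⟧)
    locally-injective : ∀ {u w v} → Adj G u w → Adj G w v → ⟦ u ⟧ ≡ ⟦ v ⟧ → u ≡ v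
open LocallyInjectiveHom

idᴸ : ∀ {G} → LocallyInjectiveHom G G
idᴸ = record { ⟦_⟧ = id ; homomorphic = id ; locally-injective = λ _ _ → id }

_⊗_ : ∀ {G G′ H H′} → LocallyInjectiveHom G G′ → LocallyInjectiveHom H H′ →
      LocallyInjectiveHom (G ×ᵍ H) (G′ ×ᵍ H′)
φ ⊗ ψ = record
  { ⟦_⟧ = map ⟦ φ ⟧ ⟦ ψ ⟧
  ; homomorphic = map (homomorphic φ) (homomorphic ψ)
  ; locally-injective = λ (uw₁ , uw₂) (wv₁ , wv₂) eq →
      cong₂ _,_ (locally-injective φ uw₁ wv₁ (cong proj₁ eq))
                (locally-injective ψ uw₂ wv₂ (cong proj₂ eq))
  }

path⟶cycle : ∀ m n .{{_ : NonZero n}} → 3 ≤ n → LocallyInjectiveHom (Path m) (Cycle n)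
path⟶cycle m n 3≤n = record { ⟦_⟧ = ⟦_⟧′ ; homomorphic = hom ; locally-injective = locInj }
  where
  ⟦_⟧′ : Fin m → Fin n
  ⟦ i ⟧′ = toℕ i mod n

  toℕ-⟦⟧ : ∀ i → toℕ ⟦ i ⟧′ ≡ toℕ i % n
  toℕ-⟦⟧ i = toℕ-fromℕ< (m%n<n (toℕ i) n)

  step : ∀ {i j} → toℕ j ≡ suc (toℕ i) → toℕ ⟦ j ⟧′ ≡ suc (toℕ ⟦ i ⟧′) % n
  step {i} {j} e = begin
    toℕ ⟦ j ⟧′               ≡⟨ toℕ-⟦⟧ j ⟩
    toℕ j % n                ≡⟨ %-congˡ e ⟩
    suc (toℕ i) % n          ≡⟨ [1+m]%n≡[1+m%n]%n (toℕ i) n ⟩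
    suc (toℕ i % n) % n      ≡⟨ cong (λ y → suc y % n) (sym (toℕ-⟦⟧ i)) ⟩
    suc (toℕ ⟦ i ⟧′) % n     ∎
    where open ≡-Reasoning

  hom : ∀ {i j} → Adj (Path m) i j → Adj (Cycle n) ⟦ i ⟧′ ⟦ j ⟧′
  hom (inj₁ e) = inj₁ (step e)
  hom (inj₂ e) = inj₂ (step e)

  -- Two steps in the same direction move by 2, which is invisible mod n only if n ∣ 2.
  two-apart : ∀ {i j} → toℕ j ≡ 2 + toℕ i → ⟦ i ⟧′ ≢ ⟦ j ⟧′
  two-apart {i} {j} e eq = <⇒≱ 3≤n (∣⇒≤ ([k+m]%n≡m%n⇒n∣k 2 (toℕ i) n (begin
    (2 + toℕ i) % n  ≡⟨ %-congˡ (sym e) ⟩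
    toℕ j % n        ≡⟨ sym (toℕ-⟦⟧ j) ⟩
    toℕ ⟦ j ⟧′       ≡⟨ cong toℕ (sym eq) ⟩
    toℕ ⟦ i ⟧′       ≡⟨ toℕ-⟦⟧ i ⟩
    toℕ i % n        ∎)))
    where open ≡-Reasoning

  locInj : ∀ {i k j} → Adj (Path m) i k → Adj (Path m) k j → ⟦ i ⟧′ ≡ ⟦ j ⟧′ → i ≡ j
  locInj (inj₁ ik) (inj₁ kj) eq = ⊥-elim (two-apart (trans kj (cong suc ik)) eq)
  locInj (inj₂ ki) (inj₂ jk) eq = ⊥-elim (two-apart (trans ki (cong suc jk)) (sym eq))
  locInj (inj₁ ik) (inj₂ kj) _  = toℕ-injective (ℕ.suc-injective (trans (sym ik) kj))
  locInj (inj₂ ki) (inj₁ kj) _  = toℕ-injective (trans ki (sym kj))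

dist1or2-image : ∀ {G H} (φ : LocallyInjectiveHom G H) → IsIrreflexive H →
                 ∀ {u v} → Dist1or2 G u v → Dist1or2 H (⟦ φ ⟧ u) (⟦ φ ⟧ v)
dist1or2-image φ irr (_ , inj₁ uv) = (λ e → irr e (homomorphic φ uv)) , inj₁ (homomorphic φ uv)
dist1or2-image φ irr (u≢v , inj₂ (w , uw , wv)) =
  (u≢v ∘ locally-injective φ uw wv) , inj₂ (⟦ φ ⟧ w , homomorphic φ uw , homomorphic φ wv)

labeling-pullback : ∀ {G H p} → LocallyInjectiveHom G H → IsIrreflexive H →
                    L11Labeling H p → L11Labeling G p
labeling-pullback φ irr (l , bounded , separated) =
  l ∘ ⟦ φ ⟧ , bounded ∘ ⟦ φ ⟧ , λ u v d → separated _ _ (dist1or2-image φ irr d)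

pairwise-close⇒≤ : ∀ {G n p} (f : Fin (suc n) → V G) →
                   (∀ a b → a ≢ b → Dist1or2 G (f a) (f b)) → L11Labeling G p → n ≤ p
pairwise-close⇒≤ {n = n} {p} f close (l , bounded , separated) = ≤-pred (injective⇒≤ label-injective)
  where
  label : Fin (suc n) → Fin (suc p)
  label a = fromℕ< (s≤s (bounded (f a)))

  label-injective : Injective _≡_ _≡_ label
  label-injective {a} {b} eq = decidable-stable (a Fin.≟ b) λ a≢b →
    separated (f a) (f b) (close a b a≢b)
      (trans (sym (toℕ-fromℕ< _)) (trans (cong toℕ eq) (toℕ-fromℕ< _)))

record Star (G : Graph) (n : ℕ) : Set where
  field
    centre         : V G
    leaf           : Fin n → V G
    leaf-injective : Injective _≡_ _≡_ leaf
    centre⟶leaf    : ∀ t → Adj G centre (leaf t)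
    leaf⟶centre    : ∀ t → Adj G (leaf t) centre

star⇒≤ : ∀ {G n p} → IsIrreflexive G → Star G n → L11Labeling G p → n ≤ p
star⇒≤ {G} irr star = pairwise-close⇒≤ (centre ∷ leaf) close
  where
  open Star star
  close : ∀ a b → a ≢ b → Dist1or2 G ((centre ∷ leaf) a) ((centre ∷ leaf) b)
  close fz     fz     a≢b = ⊥-elim (a≢b refl)
  close fz     (fs u) _   = (λ e → irr e (centre⟶leaf u)) , inj₁ (centre⟶leaf u)
  close (fs t) fz     _   = (λ e → irr e (leaf⟶centre t)) , inj₁ (leaf⟶centre t)
  close (fs t) (fs u) a≢b =
    (λ e → a≢b (cong fs (leaf-injective e))) , inj₂ (centre , leaf⟶centre t , centre⟶leaf u)

C₅ : Graph
C₅ = Cycle 5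

diagonal-label : V (C₅ ×ᵍ C₅) → ℕ
diagonal-label (a , b) = (toℕ a + 2 * toℕ b) % 5

-- Moving to a neighbour changes a + 2b by ±1 ± 2, and moving to a vertex at distance 2
-- by (0 or ±2) + 2·(0 or ±2), not both 0; none of these is divisible by 5.
diagonal-label-separates : ∀ a b c d → (Adj C₅ a b × Adj C₅ c d) ⊎ (Adj² C₅ a b × Adj² C₅ c d) →
                           (a , c) ≢ (b , d) → diagonal-label (a , c) ≢ diagonal-label (b , d)
diagonal-label-separates = toWitness {a? = all? λ a → all? λ b → all? λ c → all? λ d →
    ((adj? a b ×-dec adj? c d) ⊎-dec (adj²? a b ×-dec adj²? c d)) →-dec
    (¬? (≡-dec Fin._≟_ Fin._≟_ (a , c) (b , d)) →-dec
    ¬? (diagonal-label (a , c) ℕ.≟ diagonal-label (b , d)))} _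
  where
  adj? : Decidable (Adj C₅)
  adj? = cycle-adj? 5
  adj²? : Decidable (Adj² C₅)
  adj²? u v = any? λ w → adj? u w ×-dec adj? w v

diagonal-labeling : L11Labeling (C₅ ×ᵍ C₅) 4
diagonal-labeling = diagonal-label , (λ (a , b) → ≤-pred (m%n<n (toℕ a + 2 * toℕ b) 5)) , separated
  where
  separated : ∀ u v → Dist1or2 (C₅ ×ᵍ C₅) u v → diagonal-label u ≢ diagonal-label v
  separated (a , c) (b , d) (u≢v , inj₁ (ab , cd)) =
    diagonal-label-separates a b c d (inj₁ (ab , cd)) u≢v
  separated (a , c) (b , d) (u≢v , inj₂ ((x , y) , (ax , cy) , (xb , yd))) =
    diagonal-label-separates a b c d (inj₂ ((x , ax , xb) , (y , cy , yd))) u≢v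

C₅-irreflexive : IsIrreflexive C₅
C₅-irreflexive = cycle-irreflexive (s≤s (s≤s z≤n))

path×C₅-labeling : ∀ m → L11Labeling (Path m ×ᵍ C₅) 4
path×C₅-labeling m =
  labeling-pullback (path⟶cycle m 5 (s≤s (s≤s (s≤s z≤n))) ⊗ idᴸ) (×ᵍ-irreflexiveʳ {C₅} C₅-irreflexive) diagonal-labeling

path×C₅-star : ∀ k → Star (Path (3 + k) ×ᵍ C₅) 4
path×C₅-star k = record
  { centre = fs fz , fz
  ; leaf = leaf
  ; leaf-injective = λ {a} {b} → toWitness {a? = all? λ a → all? λ b →
      ≡-dec Fin._≟_ Fin._≟_ (leaf a) (leaf b) →-dec (a Fin.≟ b)} _ a b
  ; centre⟶leaf = λ { fz → inj₂ refl , inj₁ refl ; (fs fz) → inj₂ refl , inj₂ refl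
                    ; (fs (fs fz)) → inj₁ refl , inj₁ refl ; (fs (fs (fs fz))) → inj₁ refl , inj₂ refl }
  ; leaf⟶centre = λ { fz → inj₁ refl , inj₂ refl ; (fs fz) → inj₁ refl , inj₁ refl
                    ; (fs (fs fz)) → inj₂ refl , inj₂ refl ; (fs (fs (fs fz))) → inj₂ refl , inj₁ refl }
  }
  where
  leaf : Fin 4 → V (Path (3 + k) ×ᵍ C₅)
  leaf fz                = fz , fs fz
  leaf (fs fz)           = fz , fs (fs (fs (fs fz)))
  leaf (fs (fs fz))      = fs (fs fz) , fs fz
  leaf (fs (fs (fs fz))) = fs (fs fz) , fs (fs (fs (fs fz)))

mainTheorem11 : (m : ℕ) → 3 ≤ m → λ₁¹≡ (Path m ×ᵍ Cycle 5) 4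
mainTheorem11 m@(suc (suc (suc k))) (s≤s (s≤s (s≤s _))) =
  path×C₅-labeling m , λ _ → star⇒≤ (×ᵍ-irreflexiveʳ {Path m} C₅-irreflexive) (path×C₅-star k)
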